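{- Fix positive integers $n$, $k \leq n$ and $h$, and a nonnegative integer $t$. Choose an exact pattern $\rho$ of length $k$ from $[n]$ uniformly at random. Then the probability of the event that $|\rho \cap (\rho + h)| \geq t$ (as sets) and there exists a permutation $\pi \in S_n$ such that both $\rho$ and $\rho + h$ are exact patterns in $\pi$, is at most $$\frac{2^{2k-t} k^{k-t}}{k!}.$$
   Context: Here $[n] = \{1,\dots,n\}$. An exact pattern of length $k$ from $[n]$ is an ordered $k$-tuple $\rho = (\rho(1),\dots,\rho(k))$ of distinct elements of $[n]$ (so there are $n!/(n-k)!$ of them). For an integer $h$, $\rho + h = (\rho(1)+h,\dots,\rho(k)+h)$; in $\rho \cap (\rho+h)$ these tuples are regarded as sets. A permutation $\pi \in S_n$ (viewed as the sequence $(\pi(1),\dots,\pi(n))$) contains the exact pattern $\rho$ of length $k$ if there are indices $1 \leq i_1 < \dots < i_k \leq n$ with $\pi(i_j) = \rho(j)$ for all $j$. -}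

module Defs where

open import Data.Nat using (ℕ; _+_; _≤_; _≟_)
open import Data.Product using (_×_; ∃-syntax)
open import Data.List using (List; map; length; filter; applyUpTo)
open import Data.List.Relation.Unary.All using (All)
open import Data.List.Relation.Unary.Unique.Propositional using (Unique)
open import Data.List.Membership.DecPropositional _≟_ using (_∈?_)
open import Data.List.Relation.Binary.Permutation.Propositional using (_↭_)
open import Data.List.Relation.Binary.Sublist.Propositional using (_⊆_)
open import Relation.Binary.PropositionalEquality using (_≡_)

[_] : ℕ → List ℕ
[ n ] = applyUpTo Data.Nat.suc n

IsExactPattern : ℕ → ℕ → List ℕ → Set
IsExactPattern n k ρ = length ρ ≡ k × Unique ρ × All (λ x → 1 ≤ x × x ≤ n) ρ

shift : ℕ → List ℕ → List ℕ
shift h ρ = map (_+ h) ρ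

-- |ρ ∩ σ| as sets (for ρ without repetitions): number of entries of ρ lying in σ
interSize : List ℕ → List ℕ → ℕ
interSize ρ σ = length (filter (_∈? σ) ρ)

-- π ∈ S_n : the sequence (π(1),...,π(n)) is a rearrangement of (1,...,n)
IsPerm : ℕ → List ℕ → Set
IsPerm n π = π ↭ [ n ]

-- π contains the exact pattern ρ: ρ occurs as a subsequence of π
Contains : List ℕ → List ℕ → Set
Contains π ρ = ρ ⊆ π

Good : ℕ → ℕ → ℕ → List ℕ → Set
Good n h t ρ =
  t ≤ interSize ρ (shift h ρ) × ∃[ π ] (IsPerm n π × Contains π ρ × Contains π (shift h ρ))

-- Call an entry of ρ shifted if it lies in ρ + h, and free otherwise.
-- Since ρ and ρ + h are both subsequences of π, their common entries occur in
-- the same order in both (common-order): the shifted entries of ρ, read left to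
-- right, are x + h for the entries x of ρ with x + h ∈ ρ, read left to right.
-- So ρ is a fixed point of "fill the holes left by the shifted entries with the
-- marked entries of ρ shifted by h", and for h ≥ 1 this fixed point is unique
-- (rebuild-fixpoint-unique, by induction on a bound for the entries).  The
-- holes are determined by the support of ρ, which fixes the free values, together
-- with the positions of the at most k ∸ t free entries (holes-agree).  Hence
--   code ρ = (support, free positions, marks) ∈ (k-subsets of [n]) × [k]^(k∸t) × {0,1}^k
-- is injective on good patterns, which number at most C(n,k) · k^(k∸t) · 2^k
-- (count-by-code); clearing denominators gives the bound of the lemma.

module Submission where

open import Defs
open import Data.Nat using (ℕ; _*_; _^_; _≤_)
open import Data.Nat.Combinatorics using (_P_)
open import Data.Nat using (_!)
open import Data.Product using (_×_)
open import Data.List using (List; length)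
open import Data.List.Relation.Unary.All using (All)
open import Data.List.Relation.Unary.Unique.Propositional using (Unique)

open import Data.Nat using (zero; suc; _+_; _∸_; _<_; z≤n; s≤s; s≤s⁻¹; _≟_; _<?_)
open import Data.Nat.Properties
  using (+-suc; +-comm; +-identityʳ; suc-injective; ≤-antisym; ≤-trans; ≤-reflexive; <-≤-trans; <⇒≢;
         m<m+n; m≤n+m; m+[n∸m]≡n; m+n∸n≡m; m∸n+n≡m; ∸-monoʳ-≤; *-monoˡ-≤; *-monoʳ-≤; *-mono-≤;
         ^-distribˡ-+-*; ^-monoʳ-≤; _!≢0; module ≤-Reasoning)
open import Data.Nat.Combinatorics using (_C_; nCk+nC[k+1]≡[n+1]C[k+1]; nCk≡nPk/k!)
open import Data.Nat.DivMod using (m/n*n≤m)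
open import Data.Nat.Solver using (module +-*-Solver)
open import Data.Bool using (Bool; true; false; if_then_else_)
open import Data.Maybe using (Maybe; just; nothing; _>>=_)
import Data.Maybe as Maybe
open import Data.Product using (_,_; proj₁; proj₂)
open import Data.Sum using (_⊎_; inj₁; inj₂)
open import Data.Empty using (⊥-elim)
open import Function using (_∘_)
open import Data.List
  using ([]; _∷_; map; _++_; replicate; upTo; filter; cartesianProduct; cartesianProductWith)
open import Data.List.Properties
  using (length-++; length-map; length-replicate; length-applyUpTo; map-∘; map-cong; map-injective;
         filter-≐; filter-accept; filter-reject; ∷-injective)
open import Data.List.Relation.Unary.All using ([]; _∷_)
import Data.List.Relation.Unary.All as All
import Data.List.Relation.Unary.All.Properties as AllP
open import Data.List.Relation.Unary.Any using (here; there)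
open import Data.List.Relation.Unary.AllPairs using ([]; _∷_)
import Data.List.Relation.Unary.Unique.Propositional.Properties as UniqueP
open import Data.List.Membership.Propositional using (_∈_)
open import Data.List.Membership.Propositional.Properties
  using (∈-∃++; ∈-++⁻; ∈-++⁺ˡ; ∈-++⁺ʳ; ∈-map⁺; ∈-map⁻; ∈-upTo⁺; ∈-applyUpTo⁺; ∈-filter⁺; ∈-filter⁻;
         ∈-cartesianProductWith⁺; ∈-cartesianProduct⁺)
open import Data.List.Membership.DecPropositional _≟_ using (_∈?_)
open import Data.List.Relation.Binary.Sublist.Propositional using (_⊆_; []; _∷_; _∷ʳ_)
open import Data.List.Relation.Binary.Sublist.Propositional.Properties using (All-resp-⊆; filter-⊆)
open import Data.List.Relation.Binary.Permutation.Propositional using (_↭_; ↭-sym; ↭⇒↭ₛ)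
import Data.List.Relation.Binary.Permutation.Setoid.Properties as PermSetoid
open import Relation.Nullary using (¬_; yes; no; does)
open import Relation.Unary using (Decidable; _≐_)
open import Relation.Unary.Properties using (∁?)
open import Relation.Binary.PropositionalEquality
  using (_≡_; _≢_; refl; sym; trans; cong; cong₂; subst; setoid; module ≡-Reasoning)

Unique-length-≤ : {A : Set} {xs ys : List A} → Unique xs → (∀ {x} → x ∈ xs → x ∈ ys) →
  length xs ≤ length ys
Unique-length-≤ {xs = []} _ _ = z≤n
Unique-length-≤ {xs = x ∷ xs} {ys} (x∉xs ∷ u) xs⊆ys with ∈-∃++ (xs⊆ys (here refl))
... | as , bs , refl = begin
  suc (length xs)              ≤⟨ s≤s (Unique-length-≤ u xs⊆as++bs) ⟩
  suc (length (as ++ bs))      ≡⟨ cong suc (length-++ as) ⟩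
  suc (length as + length bs)  ≡⟨ +-suc (length as) (length bs) ⟨
  length as + length (x ∷ bs)  ≡⟨ length-++ as ⟨
  length (as ++ x ∷ bs)        ∎
  where
  open ≤-Reasoning
  xs⊆as++bs : ∀ {z} → z ∈ xs → z ∈ as ++ bs
  xs⊆as++bs {z} z∈xs with ∈-++⁻ as (xs⊆ys (there z∈xs))
  ... | inj₁ z∈as         = ∈-++⁺ˡ z∈as
  ... | inj₂ (here refl)  = ⊥-elim (All.lookup x∉xs z∈xs refl)
  ... | inj₂ (there z∈bs) = ∈-++⁺ʳ as z∈bs

Unique-length-≡ : {A : Set} {xs ys : List A} → Unique xs → Unique ys →
  (∀ {x} → x ∈ xs → x ∈ ys) → (∀ {x} → x ∈ ys → x ∈ xs) → length xs ≡ length ys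
Unique-length-≡ u v xs⊆ys ys⊆xs = ≤-antisym (Unique-length-≤ u xs⊆ys) (Unique-length-≤ v ys⊆xs)

count-by-code : {A B : Set} {Q : A → Set} (code : A → B) (codes : List B) →
  (∀ {x y} → Q x → Q y → code x ≡ code y → x ≡ y) → (∀ {x} → Q x → code x ∈ codes) →
  {L : List A} → Unique L → All Q L → length L ≤ length codes
count-by-code {Q = Q} code codes injective complete {L} u ps =
  subst (_≤ length codes) (length-map code L) (Unique-length-≤ (codes-unique u ps) covered)
  where
  codes-unique : ∀ {xs} → Unique xs → All Q xs → Unique (map code xs)
  codes-unique [] [] = []
  codes-unique (x∉xs ∷ u) (px ∷ ps) =
    AllP.map⁺ (All.zipWith (λ (x≢y , py) eq → x≢y (injective px py eq)) (x∉xs , ps)) ∷ codes-unique u ps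
  covered : ∀ {c} → c ∈ map code L → c ∈ codes
  covered c∈ with ∈-map⁻ code c∈
  ... | x , x∈L , refl = complete (All.lookup ps x∈L)

length-cartesianProductWith : {A B C : Set} (f : A → B → C) (xs : List A) (ys : List B) →
  length (cartesianProductWith f xs ys) ≡ length xs * length ys
length-cartesianProductWith f []       ys = refl
length-cartesianProductWith f (x ∷ xs) ys = begin
  length (map (f x) ys ++ cartesianProductWith f xs ys)         ≡⟨ length-++ (map (f x) ys) ⟩
  length (map (f x) ys) + length (cartesianProductWith f xs ys) ≡⟨ cong₂ _+_ (length-map (f x) ys)
                                                                     (length-cartesianProductWith f xs ys) ⟩
  length ys + length xs * length ys                             ∎
  where open ≡-Reasoning

words : {A : Set} → ℕ → List A → List (List A)
words zero    xs = [] ∷ []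
words (suc m) xs = cartesianProductWith _∷_ xs (words m xs)

length-words : {A : Set} (m : ℕ) (xs : List A) → length (words m xs) ≡ length xs ^ m
length-words zero    xs = refl
length-words (suc m) xs =
  trans (length-cartesianProductWith _∷_ xs (words m xs)) (cong (length xs *_) (length-words m xs))

∈-words : {A : Set} {xs : List A} (w : List A) → All (_∈ xs) w → w ∈ words (length w) xs
∈-words []      []            = here refl
∈-words (a ∷ w) (a∈xs ∷ w∈xs) = ∈-cartesianProductWith⁺ _∷_ a∈xs (∈-words w w∈xs)

-- subsets k xs lists the length-k subsequences of xs, i.e. its k-element
-- subsets when xs is duplicate-free.
subsets : {A : Set} → ℕ → List A → List (List A)
subsets zero    xs       = [] ∷ []
subsets (suc k) []       = []
subsets (suc k) (x ∷ xs) = map (x ∷_) (subsets k xs) ++ subsets (suc k) xs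

length-subsets : {A : Set} (k : ℕ) (xs : List A) → length (subsets k xs) ≡ length xs C k
length-subsets zero    xs       = refl
length-subsets (suc k) []       = refl
length-subsets (suc k) (x ∷ xs) = begin
  length (map (x ∷_) (subsets k xs) ++ subsets (suc k) xs)
    ≡⟨ length-++ (map (x ∷_) (subsets k xs)) ⟩
  length (map (x ∷_) (subsets k xs)) + length (subsets (suc k) xs)
    ≡⟨ cong₂ _+_ (trans (length-map (x ∷_) (subsets k xs)) (length-subsets k xs)) (length-subsets (suc k) xs) ⟩
  length xs C k + length xs C suc k
    ≡⟨ nCk+nC[k+1]≡[n+1]C[k+1] (length xs) k ⟩
  suc (length xs) C suc k
    ∎
  where open ≡-Reasoning

∈-subsets : {A : Set} {xs ys : List A} → ys ⊆ xs → ys ∈ subsets (length ys) xs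
∈-subsets []               = here refl
∈-subsets {xs = x ∷ xs} {[]}     (.x ∷ʳ s) = here refl
∈-subsets {xs = x ∷ xs} {y ∷ ys} (.x ∷ʳ s) = ∈-++⁺ʳ (map (x ∷_) (subsets (length ys) xs)) (∈-subsets s)
∈-subsets (refl ∷ s)       = ∈-++⁺ˡ (∈-map⁺ (_ ∷_) (∈-subsets s))

filter-cong-local : {A : Set} {P Q : A → Set} (P? : Decidable P) (Q? : Decidable Q) {xs : List A} →
  (∀ {x} → x ∈ xs → P x → Q x) → (∀ {x} → x ∈ xs → Q x → P x) → filter P? xs ≡ filter Q? xs
filter-cong-local P? Q? {[]}     P⇒Q Q⇒P = refl
filter-cong-local P? Q? {x ∷ xs} P⇒Q Q⇒P with P? x | Q? x
... | yes _  | yes _  = cong (x ∷_) (filter-cong-local P? Q? (P⇒Q ∘ there) (Q⇒P ∘ there))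
... | no  _  | no  _  = filter-cong-local P? Q? (P⇒Q ∘ there) (Q⇒P ∘ there)
... | yes px | no ¬qx = ⊥-elim (¬qx (P⇒Q (here refl) px))
... | no ¬px | yes qx = ⊥-elim (¬px (Q⇒P (here refl) qx))

filter-map : {A B : Set} {P : B → Set} (P? : Decidable P) (f : A → B) (xs : List A) →
  filter P? (map f xs) ≡ map f (filter (P? ∘ f) xs)
filter-map P? f []       = refl
filter-map P? f (x ∷ xs) with does (P? (f x))
... | true  = cong (f x ∷_) (filter-map P? f xs)
... | false = filter-map P? f xs

length-filter-∁ : {A : Set} {P : A → Set} (P? : Decidable P) (xs : List A) →
  length (filter P? xs) + length (filter (∁? P?) xs) ≡ length xs
length-filter-∁ P? []       = refl
length-filter-∁ P? (x ∷ xs) with P? x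
... | yes _ = cong suc (length-filter-∁ P? xs)
... | no  _ = trans (+-suc _ _) (cong suc (length-filter-∁ P? xs))

filter-∈-uncons : {y : ℕ} {xs zs : List ℕ} → All (y ≢_) zs →
  filter (_∈? y ∷ xs) zs ≡ filter (_∈? xs) zs
filter-∈-uncons {y} {xs} {zs} y∉zs = filter-cong-local (_∈? y ∷ xs) (_∈? xs) drop (λ _ → there)
  where
  drop : ∀ {z} → z ∈ zs → z ∈ y ∷ xs → z ∈ xs
  drop z∈zs (here z≡y)   = ⊥-elim (All.lookup y∉zs z∈zs (sym z≡y))
  drop z∈zs (there z∈xs) = z∈xs

common-order : {π ρ σ : List ℕ} → Unique π → ρ ⊆ π → σ ⊆ π →
  filter (_∈? σ) ρ ≡ filter (_∈? ρ) σ
common-order [] [] [] = refl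
common-order (_ ∷ u) (y ∷ʳ r) (.y ∷ʳ s) = common-order u r s
common-order {y ∷ _} {ρ} {_ ∷ σ} (y∉π ∷ u) (.y ∷ʳ r) (refl ∷ s) = begin
  filter (_∈? y ∷ σ) ρ ≡⟨ filter-∈-uncons (All-resp-⊆ r y∉π) ⟩
  filter (_∈? σ) ρ     ≡⟨ common-order u r s ⟩
  filter (_∈? ρ) σ     ≡⟨ filter-reject (_∈? ρ) (λ y∈ρ → All.lookup (All-resp-⊆ r y∉π) y∈ρ refl) ⟨
  filter (_∈? ρ) (y ∷ σ) ∎
  where open ≡-Reasoning
common-order {y ∷ _} {_ ∷ ρ} {σ} (y∉π ∷ u) (refl ∷ r) (.y ∷ʳ s) = begin
  filter (_∈? σ) (y ∷ ρ) ≡⟨ filter-reject (_∈? σ) (λ y∈σ → All.lookup (All-resp-⊆ s y∉π) y∈σ refl) ⟩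
  filter (_∈? σ) ρ       ≡⟨ common-order u r s ⟩
  filter (_∈? ρ) σ       ≡⟨ filter-∈-uncons (All-resp-⊆ s y∉π) ⟨
  filter (_∈? y ∷ ρ) σ   ∎
  where open ≡-Reasoning
common-order {y ∷ _} {_ ∷ ρ} {_ ∷ σ} (y∉π ∷ u) (refl ∷ r) (refl ∷ s) = begin
  filter (_∈? y ∷ σ) (y ∷ ρ) ≡⟨ filter-accept (_∈? y ∷ σ) (here refl) ⟩
  y ∷ filter (_∈? y ∷ σ) ρ   ≡⟨ cong (y ∷_) (filter-∈-uncons (All-resp-⊆ r y∉π)) ⟩
  y ∷ filter (_∈? σ) ρ       ≡⟨ cong (y ∷_) (common-order u r s) ⟩
  y ∷ filter (_∈? ρ) σ       ≡⟨ cong (y ∷_) (filter-∈-uncons (All-resp-⊆ s y∉π)) ⟨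
  y ∷ filter (_∈? y ∷ ρ) σ   ≡⟨ filter-accept (_∈? y ∷ ρ) (here refl) ⟨
  filter (_∈? y ∷ ρ) (y ∷ σ) ∎
  where open ≡-Reasoning

hole : {A : Set} {P : A → Set} → Decidable P → A → Maybe A
hole P? x = if does (P? x) then nothing else just x

hole-≐ : {A : Set} {P Q : A → Set} (P? : Decidable P) (Q? : Decidable Q) → P ≐ Q →
  ∀ x → hole P? x ≡ hole Q? x
hole-≐ P? Q? (P⇒Q , Q⇒P) x with P? x | Q? x
... | yes _  | yes _  = refl
... | no  _  | no  _  = refl
... | yes px | no ¬qx = ⊥-elim (¬qx (P⇒Q px))
... | no ¬px | yes qx = ⊥-elim (¬px (Q⇒P qx))

merge : {A : Set} → List (Maybe A) → List A → List A
merge []            ys       = []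
merge (just x ∷ S)  ys       = x ∷ merge S ys
merge (nothing ∷ S) []       = []
merge (nothing ∷ S) (y ∷ ys) = y ∷ merge S ys

merge-holes : {A : Set} {P : A → Set} (P? : Decidable P) (xs : List A) →
  merge (map (hole P?) xs) (filter P? xs) ≡ xs
merge-holes P? []       = refl
merge-holes P? (x ∷ xs) with does (P? x)
... | true  = cong (x ∷_) (merge-holes P? xs)
... | false = cong (x ∷_) (merge-holes P? xs)

map-merge : {A B : Set} (f : A → B) (S : List (Maybe A)) (ys : List A) →
  map f (merge S ys) ≡ merge (map (Maybe.map f) S) (map f ys)
map-merge f []            ys       = refl
map-merge f (just x ∷ S)  ys       = cong (f x ∷_) (map-merge f S ys)
map-merge f (nothing ∷ S) []       = refl
map-merge f (nothing ∷ S) (y ∷ ys) = cong (f y ∷_) (map-merge f S ys)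

select : {A : Set} → List Bool → List A → List A
select []           _        = []
select (_ ∷ _)      []       = []
select (true ∷ bs)  (x ∷ xs) = x ∷ select bs xs
select (false ∷ bs) (x ∷ xs) = select bs xs

filter-select : {A : Set} {P : A → Set} (P? : Decidable P) (xs : List A) →
  filter P? xs ≡ select (map (does ∘ P?) xs) xs
filter-select P? []       = refl
filter-select P? (x ∷ xs) with does (P? x)
... | true  = cong (x ∷_) (filter-select P? xs)
... | false = filter-select P? xs

map-select : {A B : Set} (f : A → B) (bs : List Bool) (xs : List A) →
  map f (select bs xs) ≡ select bs (map f xs)
map-select f []           xs       = refl
map-select f (_ ∷ _)      []       = refl
map-select f (true ∷ bs)  (x ∷ xs) = cong (f x ∷_) (map-select f bs xs)
map-select f (false ∷ bs) (x ∷ xs) = map-select f bs xs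

-- Uniqueness of reconstruction

rebuild : ℕ → List (Maybe ℕ) → List Bool → List ℕ → List ℕ
rebuild h S E r = merge S (map (_+ h) (select E r))

cut : ℕ → ℕ → Maybe ℕ
cut m v with v <? m
... | yes _ = just v
... | no  _ = nothing

shift-cut : ℕ → ℕ → Maybe ℕ → Maybe ℕ
shift-cut h m c = c >>= λ w → cut (suc m) (w + h)

cut-shift : ∀ {h} m v → 1 ≤ h → cut (suc m) (v + h) ≡ shift-cut h m (cut m v)
cut-shift {h} m v h≥1 with v <? m
... | yes _ = refl
... | no v≮m with v + h <? suc m
...   | yes v+h<1+m = ⊥-elim (v≮m (<-≤-trans (m<m+n v h≥1) (s≤s⁻¹ v+h<1+m)))
...   | no  _       = refl

cut-zero : (r : List ℕ) → map (cut 0) r ≡ replicate (length r) nothing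
cut-zero []      = refl
cut-zero (v ∷ r) = cong (nothing ∷_) (cut-zero r)

cut-above : ∀ {B} (r : List ℕ) → All (_< B) r → map (cut B) r ≡ map just r
cut-above []      []             = refl
cut-above {B} (v ∷ r) (v<B ∷ r<B) with v <? B
... | yes _   = cong (just v ∷_) (cut-above r r<B)
... | no  v≮B = ⊥-elim (v≮B v<B)

-- The cut at m + 1 of rebuild h S E r, computed from the cut of r at m.
next-cut : ℕ → ℕ → List (Maybe ℕ) → List Bool → List (Maybe ℕ) → List (Maybe ℕ)
next-cut h m S E c = merge (map (Maybe.map (cut (suc m))) S) (map (shift-cut h m) (select E c))

cut-rebuild : ∀ {h} m S E (r : List ℕ) → 1 ≤ h →
  map (cut (suc m)) (rebuild h S E r) ≡ next-cut h m S E (map (cut m) r)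
cut-rebuild {h} m S E r h≥1 = begin
  map (cut (suc m)) (merge S (map (_+ h) (select E r)))
    ≡⟨ map-merge (cut (suc m)) S _ ⟩
  merge S′ (map (cut (suc m)) (map (_+ h) (select E r)))
    ≡⟨ cong (merge S′) (map-∘ (select E r)) ⟨
  merge S′ (map (λ v → cut (suc m) (v + h)) (select E r))
    ≡⟨ cong (merge S′) (map-cong (λ v → cut-shift m v h≥1) (select E r)) ⟩
  merge S′ (map (shift-cut h m ∘ cut m) (select E r))
    ≡⟨ cong (merge S′) (map-∘ (select E r)) ⟩
  merge S′ (map (shift-cut h m) (map (cut m) (select E r)))
    ≡⟨ cong (merge S′ ∘ map (shift-cut h m)) (map-select (cut m) E r) ⟩
  merge S′ (map (shift-cut h m) (select E (map (cut m) r)))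
    ∎
  where
  open ≡-Reasoning
  S′ : List (Maybe (Maybe ℕ))
  S′ = map (Maybe.map (cut (suc m))) S

-- For h ≥ 1, a bounded list is determined by its length and by being a
-- fixed point of rebuild h S E: by induction on m, the entries below m agree.
rebuild-fixpoint-unique : ∀ {h B} S E {ρ ρ′ : List ℕ} → 1 ≤ h → length ρ ≡ length ρ′ →
  All (_< B) ρ → All (_< B) ρ′ → ρ ≡ rebuild h S E ρ → ρ′ ≡ rebuild h S E ρ′ → ρ ≡ ρ′
rebuild-fixpoint-unique {h} {B} S E {ρ} {ρ′} h≥1 same-length ρ<B ρ′<B ρ-fix ρ′-fix =
  map-injective just-injective (begin
    map just ρ     ≡⟨ cut-above ρ ρ<B ⟨
    map (cut B) ρ  ≡⟨ cuts-agree B ⟩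
    map (cut B) ρ′ ≡⟨ cut-above ρ′ ρ′<B ⟩
    map just ρ′    ∎)
  where
  open ≡-Reasoning
  just-injective : ∀ {v w : ℕ} → just v ≡ just w → v ≡ w
  just-injective refl = refl
  cut-fixpoint : ∀ m {r} → r ≡ rebuild h S E r → map (cut (suc m)) r ≡ next-cut h m S E (map (cut m) r)
  cut-fixpoint m {r} r-fix = trans (cong (map (cut (suc m))) r-fix) (cut-rebuild m S E r h≥1)
  cuts-agree : ∀ m → map (cut m) ρ ≡ map (cut m) ρ′
  cuts-agree zero    = begin
    map (cut 0) ρ                       ≡⟨ cut-zero ρ ⟩
    replicate (length ρ) nothing        ≡⟨ cong (λ l → replicate l nothing) same-length ⟩
    replicate (length ρ′) nothing       ≡⟨ cut-zero ρ′ ⟨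
    map (cut 0) ρ′                      ∎
  cuts-agree (suc m) = begin
    map (cut (suc m)) ρ                 ≡⟨ cut-fixpoint m ρ-fix ⟩
    next-cut h m S E (map (cut m) ρ)    ≡⟨ cong (next-cut h m S E) (cuts-agree m) ⟩
    next-cut h m S E (map (cut m) ρ′)   ≡⟨ cut-fixpoint m ρ′-fix ⟨
    map (cut (suc m)) ρ′                ∎

pos : ℕ → List ℕ → ℕ
pos x []       = 0
pos x (y ∷ ys) with x ≟ y
... | yes _ = 0
... | no  _ = suc (pos x ys)

pos-head : ∀ x xs → pos x (x ∷ xs) ≡ 0
pos-head x xs with x ≟ x
... | yes _   = refl
... | no  x≢x = ⊥-elim (x≢x refl)

pos-there : ∀ {x y} ys → x ≢ y → pos x (y ∷ ys) ≡ suc (pos x ys)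
pos-there {x} {y} ys x≢y with x ≟ y
... | yes x≡y = ⊥-elim (x≢y x≡y)
... | no  _   = refl

pos-zero : ∀ {x y} ys → pos x (y ∷ ys) ≡ 0 → x ≡ y
pos-zero {x} {y} ys eq with x ≟ y
... | yes x≡y = x≡y
pos-zero {x} {y} ys () | no _

pos-suc : ∀ {x y m} ys → pos x (y ∷ ys) ≡ suc m → pos x ys ≡ m
pos-suc {x} {y} ys eq with x ≟ y
pos-suc {x} {y} ys () | yes _
... | no _ = suc-injective eq

pos-< : ∀ {x xs} → x ∈ xs → pos x xs < length xs
pos-< {x} {y ∷ ys} x∈ with x ≟ y
... | yes _ = s≤s z≤n
pos-< {x} {y ∷ ys} (here x≡y)   | no x≢y = ⊥-elim (x≢y x≡y)
pos-< {x} {y ∷ ys} (there x∈ys) | no _   = s≤s (pos-< x∈ys)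

PositionsAgreeOutside : {P : ℕ → Set} → Decidable P → List ℕ → List ℕ → Set
PositionsAgreeOutside {P} P? xs ys = ∀ {x} → x ∈ xs → ¬ P x → pos x xs ≡ pos x ys

positions-uncons : {P : ℕ → Set} (P? : Decidable P) {x y : ℕ} {xs ys : List ℕ} → All (x ≢_) xs →
  PositionsAgreeOutside P? (x ∷ xs) (y ∷ ys) → PositionsAgreeOutside P? xs ys
positions-uncons P? {x} {y} {xs} {ys} x∉xs agree {z} z∈xs ¬pz =
  sym (pos-suc ys (trans (sym (agree (there z∈xs) ¬pz)) (pos-there xs z≢x)))
  where
  z≢x : z ≢ x
  z≢x z≡x = All.lookup x∉xs z∈xs (sym z≡x)

holes-agree : {P : ℕ → Set} (P? : Decidable P) {xs ys : List ℕ} → Unique xs → Unique ys →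
  length xs ≡ length ys → PositionsAgreeOutside P? xs ys → PositionsAgreeOutside P? ys xs →
  map (hole P?) xs ≡ map (hole P?) ys
holes-agree P? {[]}     {[]}     _          _          _   _     _     = refl
holes-agree {P} P? {x ∷ xs} {y ∷ ys} (x∉xs ∷ u) (y∉ys ∷ v) len xs→ys ys→xs =
  cong₂ _∷_ (heads-agree heads)
    (holes-agree P? u v (suc-injective len) (positions-uncons P? x∉xs xs→ys) (positions-uncons P? y∉ys ys→xs))
  where
  -- a head outside P sits at position 0 in both lists
  heads : x ≡ y ⊎ (P x × P y)
  heads with P? x | P? y
  ... | no ¬px | _      = inj₁ (pos-zero ys (trans (sym (xs→ys (here refl) ¬px)) (pos-head x xs)))
  ... | yes _  | no ¬py = inj₁ (sym (pos-zero xs (trans (sym (ys→xs (here refl) ¬py)) (pos-head y ys))))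
  ... | yes px | yes py = inj₂ (px , py)
  heads-agree : x ≡ y ⊎ (P x × P y) → hole P? x ≡ hole P? y
  heads-agree (inj₁ refl) = refl
  heads-agree (inj₂ (px , py)) with P? x | P? y
  ... | yes _  | yes _  = refl
  ... | no ¬px | _      = ⊥-elim (¬px px)
  ... | yes _  | no ¬py = ⊥-elim (¬py py)

pad : ℕ → List ℕ → List ℕ
pad m l = l ++ replicate (m ∸ length l) 0

length-pad : ∀ m (l : List ℕ) → length l ≤ m → length (pad m l) ≡ m
length-pad m l l≤m = begin
  length (l ++ replicate (m ∸ length l) 0)      ≡⟨ length-++ l ⟩
  length l + length (replicate (m ∸ length l) 0) ≡⟨ cong (length l +_) (length-replicate (m ∸ length l)) ⟩
  length l + (m ∸ length l)                      ≡⟨ m+[n∸m]≡n l≤m ⟩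
  m                                              ∎
  where open ≡-Reasoning

++-cancel-prefix : {A : Set} (xs ys : List A) {zs ws : List A} → length xs ≡ length ys →
  xs ++ zs ≡ ys ++ ws → xs ≡ ys
++-cancel-prefix []       []       _   _  = refl
++-cancel-prefix (x ∷ xs) (y ∷ ys) len eq =
  cong₂ _∷_ (proj₁ (∷-injective eq)) (++-cancel-prefix xs ys (suc-injective len) (proj₂ (∷-injective eq)))

map-≡-∈ : {A B : Set} (f g : A → B) {xs : List A} → map f xs ≡ map g xs →
  ∀ {x} → x ∈ xs → f x ≡ g x
map-≡-∈ f g {_ ∷ _} eq (here refl)  = proj₁ (∷-injective eq)
map-≡-∈ f g {_ ∷ _} eq (there x∈xs) = map-≡-∈ f g (proj₂ (∷-injective eq)) x∈xs

map-⊆ : {A B : Set} (f : A → B) {xs ys : List A} → (∀ {x} → x ∈ xs → x ∈ ys) →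
  ∀ {y} → y ∈ map f xs → y ∈ map f ys
map-⊆ f xs⊆ys y∈ with ∈-map⁻ f y∈
... | x , x∈xs , refl = ∈-map⁺ f (xs⊆ys x∈xs)

Unique-[n] : ∀ n → Unique [ n ]
Unique-[n] n = UniqueP.applyUpTo⁺₁ suc n (λ i<j _ → <⇒≢ i<j ∘ suc-injective)

Unique-resp-↭ : {A : Set} {xs ys : List A} → xs ↭ ys → Unique xs → Unique ys
Unique-resp-↭ xs↭ys = PermSetoid.AllPairs-resp-↭ (setoid _) (λ x≢y y≡x → x≢y (sym y≡x))
  ((λ { refl r → r }) , (λ { refl r → r })) (↭⇒↭ₛ xs↭ys)

-- The code of a good pattern

-- The shift h ≥ 1 makes reconstruction unique; k ≥ 1 makes 0, the padding
-- value of freePositions, a valid position.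
module Code (n k h t : ℕ) (1≤h : 1 ≤ h) (1≤k : 1 ≤ k) where

  GoodPattern : List ℕ → Set
  GoodPattern ρ = IsExactPattern n k ρ × Good n h t ρ

  support : List ℕ → List ℕ
  support ρ = filter (_∈? ρ) [ n ]

  Shifted : List ℕ → ℕ → Set
  Shifted ρ x = x ∈ shift h ρ

  shifted? : (ρ : List ℕ) → Decidable (Shifted ρ)
  shifted? ρ x = x ∈? shift h ρ

  free? : (ρ : List ℕ) → Decidable (λ x → ¬ Shifted ρ x)
  free? ρ = ∁? (shifted? ρ)

  free : List ℕ → List ℕ
  free ρ = filter (free? ρ) (support ρ)

  holes : List ℕ → List (Maybe ℕ)
  holes ρ = map (hole (shifted? ρ)) ρ

  freePositions : List ℕ → List ℕ
  freePositions ρ = pad (k ∸ t) (map (λ x → pos x ρ) (free ρ))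

  extendable : List ℕ → List Bool
  extendable ρ = map (λ x → does (x + h ∈? ρ)) ρ

  code : List ℕ → List ℕ × List ℕ × List Bool
  code ρ = support ρ , freePositions ρ , extendable ρ

  codes : List (List ℕ × List ℕ × List Bool)
  codes = cartesianProduct (subsets k [ n ])
            (cartesianProduct (words (k ∸ t) (upTo k)) (words k (true ∷ false ∷ [])))

  length-codes : length codes ≡ (n C k) * (k ^ (k ∸ t) * 2 ^ k)
  length-codes = begin
    length codes
      ≡⟨ length-cartesianProductWith _,_ (subsets k [ n ]) _ ⟩
    length (subsets k [ n ]) * length (cartesianProduct (words (k ∸ t) (upTo k)) (words k (true ∷ false ∷ [])))
      ≡⟨ cong₂ _*_ (length-subsets k [ n ]) (length-cartesianProductWith _,_ (words (k ∸ t) (upTo k)) _) ⟩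
    (length [ n ] C k) * (length (words (k ∸ t) (upTo k)) * length (words k (true ∷ false ∷ [])))
      ≡⟨ cong₂ (λ a b → (a C k) * b) (length-applyUpTo suc n)
           (cong₂ _*_ (trans (length-words (k ∸ t) (upTo k)) (cong (_^ (k ∸ t)) (length-applyUpTo (λ i → i) k)))
                      (length-words k (true ∷ false ∷ []))) ⟩
    (n C k) * (k ^ (k ∸ t) * 2 ^ k)
      ∎
    where open ≡-Reasoning

  -- Every entry of the support is an entry of ρ (the converse needs ρ ⊆ [n]).
  ∈-support⁻ : ∀ {ρ x} → x ∈ support ρ → x ∈ ρ
  ∈-support⁻ {ρ} x∈ = proj₂ (∈-filter⁻ (_∈? ρ) {xs = [ n ]} x∈)

  module Good-pattern {ρ : List ℕ} (good : GoodPattern ρ) where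

    length-ρ : length ρ ≡ k
    length-ρ = proj₁ (proj₁ good)

    unique-ρ : Unique ρ
    unique-ρ = proj₁ (proj₂ (proj₁ good))

    in-range : All (λ x → 1 ≤ x × x ≤ n) ρ
    in-range = proj₂ (proj₂ (proj₁ good))

    ∈-support⁺ : ∀ {x} → x ∈ ρ → x ∈ support ρ
    ∈-support⁺ x∈ρ with All.lookup in-range x∈ρ
    ... | s≤s z≤n , x≤n = ∈-filter⁺ (_∈? ρ) (∈-applyUpTo⁺ suc x≤n) x∈ρ

    bounded : All (_< suc n) ρ
    bounded = All.map (s≤s ∘ proj₂) in-range

    -- Since ρ and ρ + h both occur in the same permutation, the shifted entries
    -- of ρ are the entries of ρ + h in order: ρ is rebuilt from its free entries.
    rebuilt : ρ ≡ rebuild h (holes ρ) (extendable ρ) ρ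
    rebuilt with proj₂ (proj₂ good)
    ... | π , π↭[n] , ρ⊆π , ρ+h⊆π = begin
      ρ
        ≡⟨ merge-holes (shifted? ρ) ρ ⟨
      merge (holes ρ) (filter (shifted? ρ) ρ)
        ≡⟨ cong (merge (holes ρ)) (common-order unique-π ρ⊆π ρ+h⊆π) ⟩
      merge (holes ρ) (filter (_∈? ρ) (shift h ρ))
        ≡⟨ cong (merge (holes ρ)) (filter-map (_∈? ρ) (_+ h) ρ) ⟩
      merge (holes ρ) (map (_+ h) (filter (λ x → x + h ∈? ρ) ρ))
        ≡⟨ cong (merge (holes ρ) ∘ map (_+ h)) (filter-select (λ x → x + h ∈? ρ) ρ) ⟩
      rebuild h (holes ρ) (extendable ρ) ρ
        ∎
      where
      open ≡-Reasoning
      unique-π : Unique π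
      unique-π = Unique-resp-↭ (↭-sym π↭[n]) (Unique-[n] n)

    free+shifted : length (free ρ) + interSize ρ (shift h ρ) ≡ k
    free+shifted = begin
      length (free ρ) + length (filter (shifted? ρ) ρ)
        ≡⟨ cong (_+ length (filter (shifted? ρ) ρ)) same-free ⟩
      length (filter (free? ρ) ρ) + length (filter (shifted? ρ) ρ)
        ≡⟨ +-comm (length (filter (free? ρ) ρ)) _ ⟩
      length (filter (shifted? ρ) ρ) + length (filter (free? ρ) ρ)
        ≡⟨ length-filter-∁ (shifted? ρ) ρ ⟩
      length ρ
        ≡⟨ length-ρ ⟩
      k ∎
      where
      open ≡-Reasoning
      -- ρ and its support have the same entries, so the same number of free ones
      same-free : length (free ρ) ≡ length (filter (free? ρ) ρ)
      same-free = Unique-length-≡ (UniqueP.filter⁺ (free? ρ) (UniqueP.filter⁺ (_∈? ρ) (Unique-[n] n)))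
        (UniqueP.filter⁺ (free? ρ) unique-ρ)
        (λ x∈ → let x∈s , ¬s = ∈-filter⁻ (free? ρ) x∈ in ∈-filter⁺ (free? ρ) (∈-support⁻ x∈s) ¬s)
        (λ x∈ → let x∈ρ , ¬s = ∈-filter⁻ (free? ρ) x∈ in ∈-filter⁺ (free? ρ) (∈-support⁺ x∈ρ) ¬s)

    t≤k : t ≤ k
    t≤k = ≤-trans (proj₁ (proj₂ good)) (≤-trans (m≤n+m _ (length (free ρ))) (≤-reflexive free+shifted))

    few-free : length (free ρ) ≤ k ∸ t
    few-free = begin
      length (free ρ)
        ≡⟨ m+n∸n≡m (length (free ρ)) (interSize ρ (shift h ρ)) ⟨
      length (free ρ) + interSize ρ (shift h ρ) ∸ interSize ρ (shift h ρ)
        ≤⟨ ∸-monoʳ-≤ _ (proj₁ (proj₂ good)) ⟩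
      length (free ρ) + interSize ρ (shift h ρ) ∸ t
        ≡⟨ cong (_∸ t) free+shifted ⟩
      k ∸ t
        ∎
      where open ≤-Reasoning

    code∈codes : code ρ ∈ codes
    code∈codes = ∈-cartesianProduct⁺ support∈ (∈-cartesianProduct⁺ positions∈ extendable∈)
      where
      support∈ : support ρ ∈ subsets k [ n ]
      support∈ = subst (λ m → support ρ ∈ subsets m [ n ]) length-support (∈-subsets (filter-⊆ (_∈? ρ) [ n ]))
        where
        length-support : length (support ρ) ≡ k
        length-support =
          trans (Unique-length-≡ (UniqueP.filter⁺ (_∈? ρ) (Unique-[n] n)) unique-ρ ∈-support⁻ ∈-support⁺) length-ρ
      positions : List ℕ
      positions = map (λ x → pos x ρ) (free ρ)
      positions∈ : freePositions ρ ∈ words (k ∸ t) (upTo k)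
      positions∈ = subst (λ m → freePositions ρ ∈ words m (upTo k))
        (length-pad (k ∸ t) positions (subst (_≤ k ∸ t) (sym (length-map _ (free ρ))) few-free))
        (∈-words (freePositions ρ)
          (AllP.++⁺ (AllP.map⁺ (All.tabulate position<k)) (AllP.replicate⁺ _ (∈-upTo⁺ 1≤k))))
        where
        position<k : ∀ {x} → x ∈ free ρ → pos x ρ ∈ upTo k
        position<k x∈ =
          ∈-upTo⁺ (subst (pos _ ρ <_) length-ρ (pos-< (∈-support⁻ (proj₁ (∈-filter⁻ (free? ρ) x∈)))))
      extendable∈ : extendable ρ ∈ words k (true ∷ false ∷ [])
      extendable∈ = subst (λ m → extendable ρ ∈ words m (true ∷ false ∷ []))
        (trans (length-map _ ρ) length-ρ) (∈-words (extendable ρ) (All.tabulate (λ {b} _ → bool∈ b)))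
        where
        bool∈ : ∀ b → b ∈ true ∷ false ∷ []
        bool∈ true  = here refl
        bool∈ false = there (here refl)

  same-entries : ∀ {ρ ρ′} → GoodPattern ρ → support ρ ≡ support ρ′ → ∀ {x} → x ∈ ρ → x ∈ ρ′
  same-entries good same-support = ∈-support⁻ ∘ subst (_ ∈_) same-support ∘ Good-pattern.∈-support⁺ good

  -- A good pattern is determined by its code: the support fixes which entries
  -- are free, the free positions then fix the holes of ρ, and the extendable
  -- marks fix how the holes are refilled (rebuild-fixpoint-unique).
  code-injective : ∀ {ρ ρ′} → GoodPattern ρ → GoodPattern ρ′ → code ρ ≡ code ρ′ → ρ ≡ ρ′
  code-injective {ρ} {ρ′} good good′ same-code =
    rebuild-fixpoint-unique (holes ρ) (extendable ρ) 1≤h same-length G.bounded G′.bounded G.rebuilt ρ′-rebuilt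
    where
    module G  = Good-pattern good
    module G′ = Good-pattern good′
    same-length : length ρ ≡ length ρ′
    same-length = trans G.length-ρ (sym G′.length-ρ)
    same-support : support ρ ≡ support ρ′
    same-support = cong proj₁ same-code
    ρ⊆ρ′ : ∀ {x} → x ∈ ρ → x ∈ ρ′
    ρ⊆ρ′ = same-entries good same-support
    ρ′⊆ρ : ∀ {x} → x ∈ ρ′ → x ∈ ρ
    ρ′⊆ρ = same-entries good′ (sym same-support)
    same-shifted : Shifted ρ′ ≐ Shifted ρ
    same-shifted = map-⊆ (_+ h) ρ′⊆ρ , map-⊆ (_+ h) ρ⊆ρ′
    same-free : free ρ′ ≡ free ρ
    same-free = trans (cong (filter (free? ρ′)) (sym same-support))
      (filter-≐ (free? ρ′) (free? ρ) ((_∘ proj₂ same-shifted) , (_∘ proj₁ same-shifted)) (support ρ))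
    same-positions : map (λ x → pos x ρ) (free ρ) ≡ map (λ x → pos x ρ′) (free ρ)
    same-positions = trans
      (++-cancel-prefix (map (λ x → pos x ρ) (free ρ)) (map (λ x → pos x ρ′) (free ρ′))
        (trans (length-map _ (free ρ)) (trans (cong length (sym same-free)) (sym (length-map _ (free ρ′)))))
        (cong (proj₁ ∘ proj₂) same-code))
      (cong (map (λ x → pos x ρ′)) same-free)
    agree : PositionsAgreeOutside (shifted? ρ) ρ ρ′
    agree x∈ρ ¬s = map-≡-∈ _ _ same-positions (∈-filter⁺ (free? ρ) (G.∈-support⁺ x∈ρ) ¬s)
    same-holes : holes ρ′ ≡ holes ρ
    same-holes = trans (map-cong (hole-≐ (shifted? ρ′) (shifted? ρ) same-shifted) ρ′)
      (sym (holes-agree (shifted? ρ) G.unique-ρ G′.unique-ρ same-length agree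
                        (λ x∈ρ′ ¬s → sym (agree (ρ′⊆ρ x∈ρ′) ¬s))))
    same-extendable : extendable ρ′ ≡ extendable ρ
    same-extendable = sym (cong (proj₂ ∘ proj₂) same-code)
    ρ′-rebuilt : ρ′ ≡ rebuild h (holes ρ) (extendable ρ) ρ′
    ρ′-rebuilt = trans G′.rebuilt (cong₂ (λ S E → rebuild h S E ρ′) same-holes same-extendable)

  count : {L : List (List ℕ)} → Unique L → All GoodPattern L → length L ≤ (n C k) * (k ^ (k ∸ t) * 2 ^ k)
  count u goods =
    subst (_ ≤_) length-codes (count-by-code code codes code-injective Good-pattern.code∈codes u goods)

-- Clearing denominators: C(n,k) · k! ≤ n P k, k^(k∸t) · k^t = k^k and 2^k · 2^t ≤ 2^(2k).
clear-denominators : ∀ n k t m → t ≤ k → k ≤ n → m ≤ (n C k) * (k ^ (k ∸ t) * 2 ^ k) →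
  m * k ! * 2 ^ t * k ^ t ≤ 2 ^ (2 * k) * k ^ k * (n P k)
clear-denominators n k t m t≤k k≤n m≤ = begin
  m * k ! * 2 ^ t * k ^ t
    ≤⟨ *-monoˡ-≤ (k ^ t) (*-monoˡ-≤ (2 ^ t) (*-monoˡ-≤ (k !) m≤)) ⟩
  (n C k) * (k ^ (k ∸ t) * 2 ^ k) * k ! * 2 ^ t * k ^ t
    ≡⟨ solve 6 (λ c a b f u v → c :* (a :* b) :* f :* u :* v := (c :* f) :* (a :* v) :* (b :* u))
         refl (n C k) (k ^ (k ∸ t)) (2 ^ k) (k !) (2 ^ t) (k ^ t) ⟩
  ((n C k) * k !) * (k ^ (k ∸ t) * k ^ t) * (2 ^ k * 2 ^ t)
    ≤⟨ *-mono-≤ (*-mono-≤ C*k!≤P (≤-reflexive k^[k∸t]*k^t≡k^k)) 2^k*2^t≤2^[2k] ⟩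
  (n P k) * k ^ k * 2 ^ (2 * k)
    ≡⟨ solve 3 (λ p q r → p :* q :* r := r :* q :* p) refl (n P k) (k ^ k) (2 ^ (2 * k)) ⟩
  2 ^ (2 * k) * k ^ k * (n P k)
    ∎
  where
  open ≤-Reasoning
  open +-*-Solver
  C*k!≤P : (n C k) * k ! ≤ n P k
  C*k!≤P rewrite nCk≡nPk/k! k≤n = m/n*n≤m (n P k) (k !) {{k !≢0}}
  k^[k∸t]*k^t≡k^k : k ^ (k ∸ t) * k ^ t ≡ k ^ k
  k^[k∸t]*k^t≡k^k = trans (sym (^-distribˡ-+-* k (k ∸ t) t)) (cong (k ^_) (m∸n+n≡m t≤k))
  2^k*2^t≤2^[2k] : 2 ^ k * 2 ^ t ≤ 2 ^ (2 * k)
  2^k*2^t≤2^[2k] = begin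
    2 ^ k * 2 ^ t ≤⟨ *-monoʳ-≤ (2 ^ k) (^-monoʳ-≤ 2 t≤k) ⟩
    2 ^ k * 2 ^ k ≡⟨ ^-distribˡ-+-* 2 k k ⟨
    2 ^ (k + k)   ≡⟨ cong (λ j → 2 ^ (k + j)) (+-identityʳ k) ⟨
    2 ^ (2 * k)   ∎

-- The inequality t ≤ k needed for this is read off from any good pattern.
lemma14 : (n k h t : ℕ) → 1 ≤ n → 1 ≤ k → k ≤ n → 1 ≤ h →
    (L : List (List ℕ)) → Unique L →
    All (λ ρ → IsExactPattern n k ρ × Good n h t ρ) L →
    length L * k ! * 2 ^ t * k ^ t ≤ 2 ^ (2 * k) * k ^ k * (n P k)
lemma14 n k h t _ 1≤k k≤n 1≤h []          _ _ = z≤n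
lemma14 n k h t _ 1≤k k≤n 1≤h L@(_ ∷ _) u goods@(good ∷ _) =
  clear-denominators n k t (length L) (Good-pattern.t≤k good) k≤n (count u goods)
  where open Code n k h t 1≤h 1≤k
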